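{- Let $G$ be a connected $\{K_{1,3},Z_{2},N\}$-free graph which contains an induced subgraph $H=H_{5}(\{C_{w_{7}}\})$, where $C_{w_{7}}$ is a nonempty clique. Then for each vertex $a\in V(G)\setminus V(H)$ with $N_{G}(a)\cap V(H)\neq\emptyset$, one of the following holds: (i) $G[V(H)\cup\{a\}]\in\mathcal{H}_{5}$, or (ii) $N_{G}(a)\cap V(H)=\{w_{1},w_{2},w_{i},w_{9-i}\}$ for some $i\in\{3,4\}$ and $|C_{w_{7}}|=1$ (and so $G[V(H)\cup\{a\}]\cong H_{7}$).
   Context: All graphs are finite and simple; $N_G(a)$ is the neighborhood of $a$, $G[X]$ the induced subgraph. $\mathcal{F}$-free means no member of $\mathcal{F}$ is an induced subgraph. $K_{1,3}$ is the star with three leaves; $Z_2$ is a triangle $abc$ plus a path $ade$ on new vertices $d,e$; $N$ is a triangle with one new pendant vertex attached to each of its three vertices. Expansion: for a graph $H$, expandable set $U\subseteq V(H)$, and pairwise disjoint nonempty cliques $\mathcal{C}=\{C_a\mid a\in U\}$, $H(\mathcal{C})$ replaces each $a\in U$ by the clique $C_a$: a vertex of $C_a$ is adjacent to $u\in V(H)\setminus U$ iff $au\in E(H)$; other adjacencies as in $H$. $H_5$: vertices $w_1,\dots,w_7$, edges $w_1w_3,w_1w_5,w_3w_4,w_5w_6,w_2w_4,w_2w_6,w_7w_3,w_7w_4,w_7w_5,w_7w_6$; $U_5=\{w_7\}$. $\mathcal{H}_5$ is the family of graphs isomorphic to some $H_5(\{C_{w_7}\})$ with $C_{w_7}$ a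 nonempty clique. $H_7$: vertices $y_1,\dots,y_8$, edges $y_1y_2,y_1y_3,y_1y_5,y_2y_4,y_2y_6,y_3y_4,y_3y_5,y_3y_7,y_4y_6,y_4y_7,y_5y_6,y_5y_8,y_6y_8,y_7y_8$. -}

module Defs where

open import Data.Nat using (ℕ; zero; suc; _+_; _∸_; _≤_)
open import Data.Fin using (Fin; zero; suc; toℕ; splitAt; _↑ˡ_; fromℕ)
open import Data.Fin.Properties using (_≟_)
open import Data.Bool using (Bool; true; false; _∧_; _∨_; not)
open import Data.Bool.Properties using (∨-comm; ∧-zeroˡ)
open import Data.List using (List; []; _∷_)
open import Data.Product using (Σ; _×_; _,_; ∃; ∃-syntax)
open import Data.Sum using (_⊎_; inj₁; inj₂)
open import Relation.Nullary using (¬_; yes; no)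
open import Relation.Nullary.Decidable using (⌊_⌋)
open import Relation.Binary.PropositionalEquality using (_≡_; refl; sym; cong; cong₂)
open import Function.Definitions using (Injective)

record Graph : Set where
  field
    n      : ℕ
    adj    : Fin n → Fin n → Bool
    adj-sym    : ∀ u v → adj u v ≡ adj v u
    adj-irrefl : ∀ u → adj u u ≡ false
open Graph public

V : Graph → Set
V G = Fin (n G)

Adj : (G : Graph) → V G → V G → Set
Adj G u v = adj G u v ≡ true

private
  eqb : ∀ {k} → Fin k → Fin k → Bool
  eqb i j = ⌊ i ≟ j ⌋

  eqb-sym : ∀ {k} (i j : Fin k) → eqb i j ≡ eqb j i
  eqb-sym i j with i ≟ j | j ≟ i
  ... | yes _ | yes _ = refl
  ... | no _  | no _  = refl
  ... | yes p | no q  with q (sym p)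
  ... | ()
  eqb-sym i j | no p | yes q with p (sym q)
  ... | ()

  eqb-refl : ∀ {k} (i : Fin k) → eqb i i ≡ true
  eqb-refl i with i ≟ i
  ... | yes _ = refl
  ... | no p with p refl
  ... | ()

  memE : ∀ {k} → List (Fin k × Fin k) → Fin k → Fin k → Bool
  memE [] i j = false
  memE ((a , b) ∷ es) i j = (eqb a i ∧ eqb b j) ∨ memE es i j

edgeAdj : ∀ {k} → List (Fin k × Fin k) → Fin k → Fin k → Bool
edgeAdj es i j = not (eqb i j) ∧ (memE es i j ∨ memE es j i)

edgeAdj-sym : ∀ {k} (es : List (Fin k × Fin k)) (i j : Fin k) →
              edgeAdj es i j ≡ edgeAdj es j i
edgeAdj-sym es i j = cong₂ (λ x y → not x ∧ y) (eqb-sym i j) (∨-comm (memE es i j) (memE es j i))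

edgeAdj-irrefl : ∀ {k} (es : List (Fin k × Fin k)) (i : Fin k) → edgeAdj es i i ≡ false
edgeAdj-irrefl es i rewrite eqb-refl i = refl

fromEdges : (k : ℕ) → List (Fin k × Fin k) → Graph
fromEdges k es = record
  { n = k ; adj = edgeAdj es ; adj-sym = edgeAdj-sym es ; adj-irrefl = edgeAdj-irrefl es }

InducedEmb : (H G : Graph) → (V H → V G) → Set
InducedEmb H G f = Injective _≡_ _≡_ f × (∀ x y → adj G (f x) (f y) ≡ adj H x y)

Free : (G F : Graph) → Set
Free G F = ∀ (f : V F → V G) → ¬ InducedEmb F G f

data Reach (G : Graph) : V G → V G → Set where
  here : ∀ {u} → Reach G u u
  step : ∀ {u v w} → Adj G u v → Reach G v w → Reach G u w

Connected : Graph → Set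
Connected G = ∀ u v → Reach G u v

K13 : Graph
K13 = fromEdges 4 ((zero , suc zero) ∷ (zero , suc (suc zero)) ∷ (zero , suc (suc (suc zero))) ∷ [])

private
  f0 f1 f2 f3 f4 f5 : ∀ {k} → Fin (6 + k)
  f0 = zero
  f1 = suc zero
  f2 = suc (suc zero)
  f3 = suc (suc (suc zero))
  f4 = suc (suc (suc (suc zero)))
  f5 = suc (suc (suc (suc (suc zero))))

-- Z_2: triangle a b c (0,1,2), path a d e (0,3,4)
Z2 : Graph
Z2 = fromEdges 5 ( (zero , suc zero) ∷ (suc zero , suc (suc zero)) ∷ (zero , suc (suc zero))
                 ∷ (zero , suc (suc (suc zero))) ∷ (suc (suc (suc zero)) , suc (suc (suc (suc zero)))) ∷ [])

-- N (net): triangle 0 1 2 with pendants 3-0, 4-1, 5-2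
NetG : Graph
NetG = fromEdges 6 ( (f0 , f1) ∷ (f1 , f2) ∷ (f0 , f2) ∷ (f3 , f0) ∷ (f4 , f1) ∷ (f5 , f2) ∷ [])

-- H_5 on Fin 7, vertex w_j is the element with toℕ = j - 1
H5base : Graph
H5base = fromEdges 7
  ( (w 1 , w 3) ∷ (w 1 , w 5) ∷ (w 3 , w 4) ∷ (w 5 , w 6) ∷ (w 2 , w 4) ∷ (w 2 , w 6)
  ∷ (w 7 , w 3) ∷ (w 7 , w 4) ∷ (w 7 , w 5) ∷ (w 7 , w 6) ∷ [])
  where
  w : ℕ → Fin 7
  w 1 = f0
  w 2 = f1
  w 3 = f2
  w 4 = f3
  w 5 = f4
  w 6 = f5
  w _ = fromℕ 6

-- the vertex of H_5 a vertex of the expansion stems from: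
-- elements 0..5 of Fin (6 + m) are w_1..w_6, elements 6..6+m-1 form C_{w7}
origin : (m : ℕ) → Fin (6 + m) → Fin 7
origin m x with splitAt 6 x
... | inj₁ i = i ↑ˡ 1
... | inj₂ _ = fromℕ 6

private
  eqb7 : Fin 7 → Fin 7 → Bool
  eqb7 i j = ⌊ i ≟ j ⌋

  h5exp-adj : (m : ℕ) → Fin (6 + m) → Fin (6 + m) → Bool
  h5exp-adj m x y =
    not ⌊ x ≟ y ⌋ ∧ ((eqb7 (origin m x) (fromℕ 6) ∧ eqb7 (origin m y) (fromℕ 6))
                      ∨ adj H5base (origin m x) (origin m y))

  h5exp-sym : ∀ m x y → h5exp-adj m x y ≡ h5exp-adj m y x
  h5exp-sym m x y =
    cong₂ (λ p q → not p ∧ q) (eqb-sym x y)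
      (cong₂ _∨_ (Data.Bool.Properties.∧-comm (eqb7 (origin m x) (fromℕ 6)) _)
                 (adj-sym H5base (origin m x) (origin m y)))

  h5exp-irrefl : ∀ m x → h5exp-adj m x x ≡ false
  h5exp-irrefl m x rewrite eqb-refl x = refl

-- H_5({C_{w7}}) with |C_{w7}| = m : vertices of C_{w7} are pairwise
-- adjacent, and adjacent to exactly the H_5-neighbours of w_7.
H5exp : ℕ → Graph
H5exp m = record
  { n = 6 + m ; adj = h5exp-adj m ; adj-sym = h5exp-sym m ; adj-irrefl = h5exp-irrefl m }

IsW : (m : ℕ) → ℕ → Fin (6 + m) → Set
IsW m j x = suc (toℕ x) ≡ j × j ≤ 6

module Submission where

-- Whether a vertex a outside H = H₅({C}) creates an induced K₁,₃ or Z₂ can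
-- already be seen on w₁, …, w₆, a and a single c ∈ C.  Running by machine
-- through all 2⁷ neighbourhoods of a in {w₁, …, w₆, c} leaves exactly four:
-- none, {w₃, …, w₆, c}, and {w₁, w₂, wᵢ, w₉₋ᵢ} for i = 3, 4.  They differ on
-- w₁, …, w₆, which do not depend on c, so a treats all of C alike.  In the
-- second case a is one more vertex of the clique; in the last two, w₁, …, w₆,
-- a and two clique vertices would contain an induced Z₂, so |C| = 1.

open import Defs
open import Data.Nat using (ℕ; zero; suc; _+_; _∸_; _≤_; z≤n; s≤s)
import Data.Nat.Properties as ℕ
open import Data.Fin using (Fin; zero; suc; toℕ; splitAt; join; _↑ˡ_; _↑ʳ_; fromℕ)
import Data.Fin.Properties as Fin
open import Data.Bool using (Bool; true; false; not; _∧_; _∨_; if_then_else_)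
import Data.Bool.Properties as Bool
open import Data.List using (List; []; _∷_; allFin)
open import Data.Maybe using (Maybe; just; nothing; is-just; _<∣>_; from-just; to-witness-T)
import Data.Maybe as Maybe
open import Data.Vec using (Vec; []; _∷_; lookup; tabulate; replicate)
open import Data.Vec.Properties using (lookup∘tabulate; lookup-replicate; ≡-dec)
import Data.Vec.Functional as Vector
open import Data.Product using (_×_; _,_; proj₁; ∃-syntax)
open import Data.Sum using (_⊎_; inj₁; inj₂; [_,_]′; map₂)
open import Data.Sum.Properties using ([,]-map; inj₂-injective)
open import Data.Empty using (⊥-elim)
open import Function using (_∘_)
open import Function.Bundles using (_⇔_; mk⇔; Equivalence)
open import Function.Definitions using (Injective)
open import Relation.Nullary using (¬_; Dec; yes; no; contradiction)
open import Relation.Nullary.Decidable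
  using (⌊_⌋; _×-dec_; _⊎-dec_; _→-dec_; map′; dec⇒maybe; from-yes; dec-false; isYes≗does)
open import Relation.Binary.PropositionalEquality
  using (_≡_; _≢_; refl; sym; trans; cong; cong₂; subst; module ≡-Reasoning)

open Equivalence using (to; from)

InducedEmb-∘ : ∀ {F H G r f} → InducedEmb F H r → InducedEmb H G f → InducedEmb F G (f ∘ r)
InducedEmb-∘ {r = r} (r-inj , r-adj) (f-inj , f-adj) =
  (λ e → r-inj (f-inj e)) , λ x y → trans (f-adj (r x) (r y)) (r-adj x y)

Free-induced : ∀ {G L F h} → Free G F → InducedEmb L G h → Free L F
Free-induced {G} {L} {F} free h-emb g g-emb = free _ (InducedEmb-∘ {F} {L} {G} g-emb h-emb)

InducedEmb-inverse : ∀ {H H′ φ} (ψ : V H′ → V H) →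
  InducedEmb H H′ φ → (∀ y → φ (ψ y) ≡ y) → InducedEmb H′ H ψ
InducedEmb-inverse {H} {H′} {φ} ψ (_ , φ-adj) φψ = ψ-inj , ψ-adj
  where
  ψ-inj : Injective _≡_ _≡_ ψ
  ψ-inj {y} {y′} e = trans (sym (φψ y)) (trans (cong φ e) (φψ y′))
  ψ-adj : ∀ y y′ → adj H (ψ y) (ψ y′) ≡ adj H′ y y′
  ψ-adj y y′ = trans (sym (φ-adj (ψ y) (ψ y′))) (cong₂ (adj H′) (φψ y) (φψ y′))

addVertex : (H : Graph) → (V H → Bool) → Graph
addVertex H p = record
  { n = suc (n H) ; adj = adj⁺ ; adj-sym = adj⁺-sym ; adj-irrefl = adj⁺-irrefl }
  where
  adj⁺ : Fin (suc (n H)) → Fin (suc (n H)) → Bool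
  adj⁺ zero    zero    = false
  adj⁺ zero    (suc y) = p y
  adj⁺ (suc x) zero    = p x
  adj⁺ (suc x) (suc y) = adj H x y
  adj⁺-sym : ∀ x y → adj⁺ x y ≡ adj⁺ y x
  adj⁺-sym zero    zero    = refl
  adj⁺-sym zero    (suc y) = refl
  adj⁺-sym (suc x) zero    = refl
  adj⁺-sym (suc x) (suc y) = adj-sym H x y
  adj⁺-irrefl : ∀ x → adj⁺ x x ≡ false
  adj⁺-irrefl zero    = refl
  adj⁺-irrefl (suc x) = adj-irrefl H x

addVertex-emb : ∀ {H G f a} (p : V H → Bool) → InducedEmb H G f → (∀ x → f x ≢ a) →
  (∀ x → adj G a (f x) ≡ p x) → InducedEmb (addVertex H p) G (a Vector.∷ f)
addVertex-emb {H} {G} {f} {a} p (f-inj , f-adj) a∉f a-adj = inj , adj≡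
  where
  inj : Injective _≡_ _≡_ (a Vector.∷ f)
  inj {zero}  {zero}  _ = refl
  inj {zero}  {suc y} e = ⊥-elim (a∉f y (sym e))
  inj {suc x} {zero}  e = ⊥-elim (a∉f x e)
  inj {suc x} {suc y} e = cong suc (f-inj e)
  adj≡ : ∀ x y → adj G ((a Vector.∷ f) x) ((a Vector.∷ f) y) ≡ adj (addVertex H p) x y
  adj≡ zero    zero    = adj-irrefl G a
  adj≡ zero    (suc y) = a-adj y
  adj≡ (suc x) zero    = trans (adj-sym G (f x) a) (a-adj x)
  adj≡ (suc x) (suc y) = f-adj x y

injective? : ∀ {k n} (h : Fin k → Fin n) → Dec (Injective _≡_ _≡_ h)
injective? h = map′ (λ i {x} {y} → i x y) (λ i x y → i {x} {y})
  (Fin.all? λ x → Fin.all? λ y → h x Fin.≟ h y →-dec x Fin.≟ y)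

induced? : (F L : Graph) (h : V F → V L) → Dec (InducedEmb F L h)
induced? F L h =
  injective? h ×-dec Fin.all? λ x → Fin.all? λ y → adj L (h x) (h y) Bool.≟ adj F x y

-- Backtracking search placing the vertices of F one at a time; its answer is
-- trusted only after `induced?` confirms it (v₀ is a dummy image).  Reading
-- adjacency from precomputed tables makes `classify-total` several times faster.
module InducedSearch (F L : Graph) where

  Table : Graph → Set
  Table G = Vec (Vec Bool (n G)) (n G)

  table : (G : Graph) → Table G
  table G = tabulate λ x → tabulate λ y → adj G x y

  Placement : Set
  Placement = List (V F × V L)

  fits : Table F → Table L → Placement → V F → V L → Bool
  fits tF tL []               x v = true
  fits tF tL ((x′ , v′) ∷ ps) x v =
    not ⌊ v Fin.≟ v′ ⌋ ∧ ⌊ lookup (lookup tL v) v′ Bool.≟ lookup (lookup tF x) x′ ⌋ ∧ fits tF tL ps x v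

  firstJust : {A B : Set} → (A → Maybe B) → List A → Maybe B
  firstJust g []       = nothing
  firstJust g (u ∷ us) = g u <∣> firstJust g us

  place : Table F → Table L → Placement → List (V F) → Maybe Placement
  place tF tL ps []       = just ps
  place tF tL ps (x ∷ xs) = firstJust
    (λ v → if fits tF tL ps x v then place tF tL ((x , v) ∷ ps) xs else nothing) (allFin (n L))

  assignment : V L → Placement → V F → V L
  assignment v₀ []              x = v₀
  assignment v₀ ((x′ , v) ∷ ps) x = if ⌊ x Fin.≟ x′ ⌋ then v else assignment v₀ ps x

  find : V L → Maybe (∃[ h ] InducedEmb F L h)
  find v₀ with place (table F) (table L) [] (allFin (n F))
  ... | nothing = nothing
  ... | just ps = Maybe.map (assignment v₀ ps ,_) (dec⇒maybe (induced? F L (assignment v₀ ps)))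

ClawOrZ2 : Graph → Set
ClawOrZ2 L = (∃[ h ] InducedEmb K13 L h) ⊎ (∃[ h ] InducedEmb Z2 L h)

clawOrZ2? : (L : Graph) → V L → Maybe (ClawOrZ2 L)
clawOrZ2? L v₀ =
  Maybe.map inj₁ (InducedSearch.find K13 L v₀) <∣> Maybe.map inj₂ (InducedSearch.find Z2 L v₀)

ClawOrZ2-free : ∀ {G L h} → Free G K13 → Free G Z2 → InducedEmb L G h → ¬ ClawOrZ2 L
ClawOrZ2-free {G} {L} claw-free _ h-emb (inj₁ (g , g-emb)) =
  Free-induced {G} {L} {K13} claw-free h-emb g g-emb
ClawOrZ2-free {G} {L} _ z2-free h-emb (inj₂ (g , g-emb)) =
  Free-induced {G} {L} {Z2} z2-free h-emb g g-emb

-- Vertices of H5exp k are w₁ … w₆ (as i ↑ˡ k) followed by the clique (as 6 ↑ʳ c).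
liftClique : ∀ {k m} → (Fin k → Fin m) → Fin (6 + k) → Fin (6 + m)
liftClique {m = m} σ = join 6 m ∘ map₂ σ ∘ splitAt 6

splitAt-liftClique : ∀ {k m} (σ : Fin k → Fin m) x →
  splitAt 6 (liftClique σ x) ≡ map₂ σ (splitAt 6 x)
splitAt-liftClique {m = m} σ x = Fin.splitAt-join 6 m (map₂ σ (splitAt 6 x))

map₂-injective : ∀ {A B C : Set} {σ : B → C} → Injective _≡_ _≡_ σ →
  Injective _≡_ _≡_ (map₂ {A = A} σ)
map₂-injective σ-inj {inj₁ _} {inj₁ _} refl = refl
map₂-injective σ-inj {inj₂ _} {inj₂ _} e    = cong inj₂ (σ-inj (inj₂-injective e))

liftClique-injective : ∀ {k m} {σ : Fin k → Fin m} → Injective _≡_ _≡_ σ →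
  Injective _≡_ _≡_ (liftClique σ)
liftClique-injective {k} {σ = σ} σ-inj {x} {y} e = begin
  x                     ≡⟨ sym (Fin.join-splitAt 6 k x) ⟩
  join 6 k (splitAt 6 x) ≡⟨ cong (join 6 k) (map₂-injective σ-inj {splitAt 6 x} {splitAt 6 y} split≡) ⟩
  join 6 k (splitAt 6 y) ≡⟨ Fin.join-splitAt 6 k y ⟩
  y                     ∎
  where
  open ≡-Reasoning
  split≡ : map₂ σ (splitAt 6 x) ≡ map₂ σ (splitAt 6 y)
  split≡ = trans (sym (splitAt-liftClique σ x))
                 (trans (cong (splitAt 6) e) (splitAt-liftClique σ y))

origin-splitAt : ∀ m x → origin m x ≡ [ _↑ˡ 1 , (λ _ → fromℕ 6) ]′ (splitAt 6 x)
origin-splitAt m x with splitAt 6 x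
... | inj₁ _ = refl
... | inj₂ _ = refl

origin-liftClique : ∀ {k m} (σ : Fin k → Fin m) x → origin m (liftClique σ x) ≡ origin k x
origin-liftClique {k} {m} σ x = begin
  origin m (liftClique σ x)                           ≡⟨ origin-splitAt m (liftClique σ x) ⟩
  [ _↑ˡ 1 , _ ]′ (splitAt 6 (liftClique σ x))         ≡⟨ cong [ _↑ˡ 1 , _ ]′ (splitAt-liftClique σ x) ⟩
  [ _↑ˡ 1 , _ ]′ (map₂ σ (splitAt 6 x))               ≡⟨ [,]-map (splitAt 6 x) ⟩
  [ _↑ˡ 1 , (λ _ → fromℕ 6) ]′ (splitAt 6 x)          ≡⟨ sym (origin-splitAt k x) ⟩
  origin k x                                          ∎
  where open ≡-Reasoning

-- w₇ counts as adjacent to itself because C_{w₇} is a clique.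
originAdj : Fin 7 → Fin 7 → Bool
originAdj s t = (⌊ s Fin.≟ fromℕ 6 ⌋ ∧ ⌊ t Fin.≟ fromℕ 6 ⌋) ∨ adj H5base s t

H5exp-adj : ∀ m x y → adj (H5exp m) x y ≡ not ⌊ x Fin.≟ y ⌋ ∧ originAdj (origin m x) (origin m y)
H5exp-adj m x y = refl

⌊≟⌋-injective : ∀ {k n} {h : Fin k → Fin n} → Injective _≡_ _≡_ h →
  ∀ x y → ⌊ h x Fin.≟ h y ⌋ ≡ ⌊ x Fin.≟ y ⌋
⌊≟⌋-injective {h = h} h-inj x y with h x Fin.≟ h y | x Fin.≟ y
... | yes _  | yes _  = refl
... | no _   | no _   = refl
... | yes e  | no x≢y = ⊥-elim (x≢y (h-inj e))
... | no ≢   | yes e  = ⊥-elim (≢ (cong h e))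

liftClique-emb : ∀ {k m} {σ : Fin k → Fin m} → Injective _≡_ _≡_ σ →
  InducedEmb (H5exp k) (H5exp m) (liftClique σ)
liftClique-emb {k} {m} {σ} σ-inj = lift-inj , λ x y → begin
  adj (H5exp m) (liftClique σ x) (liftClique σ y)
    ≡⟨ H5exp-adj m (liftClique σ x) (liftClique σ y) ⟩
  not ⌊ liftClique σ x Fin.≟ liftClique σ y ⌋
    ∧ originAdj (origin m (liftClique σ x)) (origin m (liftClique σ y))
    ≡⟨ cong₂ (λ d o → not d ∧ o) (⌊≟⌋-injective lift-inj x y)
             (cong₂ originAdj (origin-liftClique σ x) (origin-liftClique σ y)) ⟩
  not ⌊ x Fin.≟ y ⌋ ∧ originAdj (origin k x) (origin k y)
    ≡⟨ H5exp-adj k x y ⟨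
  adj (H5exp k) x y
    ∎
  where
  open ≡-Reasoning
  lift-inj = liftClique-injective σ-inj

attachment : ∀ {k} → Vec Bool 6 → (Fin k → Bool) → Fin (6 + k) → Bool
attachment W β = [ lookup W , β ]′ ∘ splitAt 6

Attached : (k : ℕ) → Vec Bool 6 → (Fin k → Bool) → Graph
Attached k W β = addVertex (H5exp k) (attachment W β)

attachment-liftClique : ∀ {k m} W (β : Fin m → Bool) (σ : Fin k → Fin m) x →
  attachment W β (liftClique σ x) ≡ attachment W (β ∘ σ) x
attachment-liftClique W β σ x =
  trans (cong [ lookup W , β ]′ (splitAt-liftClique σ x)) ([,]-map (splitAt 6 x))

attached-emb : ∀ {G k m} {f : Fin (6 + m) → V G} {a W β} {σ : Fin k → Fin m} →
  InducedEmb (H5exp m) G f → (∀ x → f x ≢ a) → (∀ x → adj G a (f x) ≡ attachment W β x) →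
  Injective _≡_ _≡_ σ → InducedEmb (Attached k W (β ∘ σ)) G (a Vector.∷ (f ∘ liftClique σ))
attached-emb {G} {k} {m} {W = W} {β} {σ} f-emb a∉f a-adj σ-inj =
  addVertex-emb {H5exp k} {G} (attachment W (β ∘ σ))
    (InducedEmb-∘ {H5exp k} {H5exp m} {G} (liftClique-emb σ-inj) f-emb)
    (λ x → a∉f (liftClique σ x))
    (λ x → trans (a-adj (liftClique σ x)) (attachment-liftClique W β σ x))

twin-pattern : Vec Bool 6
twin-pattern = tabulate λ i → originAdj (fromℕ 6) (i ↑ˡ 1)

h7-pattern : ℕ → Vec Bool 6
h7-pattern i = tabulate λ j →
  let w = suc (toℕ j) in ⌊ w ℕ.≟ 1 ⌋ ∨ ⌊ w ℕ.≟ 2 ⌋ ∨ ⌊ w ℕ.≟ i ⌋ ∨ ⌊ w ℕ.≟ 9 ∸ i ⌋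

data Admissible : Vec Bool 6 → Bool → Set where
  isolated : Admissible (replicate 6 false) false
  twin     : Admissible twin-pattern true
  h7       : ∀ {i} → i ≡ 3 ⊎ i ≡ 4 → Admissible (h7-pattern i) false

admissible? : ∀ W b → Maybe (Admissible W b)
admissible? (false ∷ false ∷ false ∷ false ∷ false ∷ false ∷ []) false = just isolated
admissible? (false ∷ false ∷ true  ∷ true  ∷ true  ∷ true  ∷ []) true  = just twin
admissible? (true  ∷ true  ∷ true  ∷ false ∷ false ∷ true  ∷ []) false = just (h7 (inj₁ refl))
admissible? (true  ∷ true  ∷ false ∷ true  ∷ true  ∷ false ∷ []) false = just (h7 (inj₂ refl))
admissible? _ _ = nothing

Admissible-clique : ∀ {W b} → Admissible W b → b ≡ ⌊ ≡-dec Bool._≟_ W twin-pattern ⌋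
Admissible-clique isolated          = refl
Admissible-clique twin              = refl
Admissible-clique (h7 (inj₁ refl)) = refl
Admissible-clique (h7 (inj₂ refl)) = refl

allVec : ∀ k → (Vec Bool k → Bool) → Bool
allVec zero    p = p []
allVec (suc k) p = allVec k (p ∘ (true ∷_)) ∧ allVec k (p ∘ (false ∷_))

allVec-sound : ∀ k p → allVec k p ≡ true → ∀ v → p v ≡ true
allVec-sound zero    p t []          = t
allVec-sound (suc k) p t (true ∷ v)  = allVec-sound k _ (Bool.∧-conicalˡ _ _ t) v
allVec-sound (suc k) p t (false ∷ v) = allVec-sound k _ (Bool.∧-conicalʳ _ _ t) v

classify? : ∀ W b → Maybe (ClawOrZ2 (Attached 1 W (λ _ → b)) ⊎ Admissible W b)
classify? W b =
  Maybe.map inj₂ (admissible? W b) <∣> Maybe.map inj₁ (clawOrZ2? (Attached 1 W (λ _ → b)) zero)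

classifiable : Vec Bool 7 → Bool
classifiable (b ∷ W) = is-just (classify? W b)

-- Opaque, so that the 128 cases are evaluated only here and not again
-- wherever `classify` is used.
opaque
  classify-total : allVec 7 classifiable ≡ true
  classify-total = refl

  classify : ∀ W b → ClawOrZ2 (Attached 1 W (λ _ → b)) ⊎ Admissible W b
  classify W b = to-witness-T (classify? W b)
    (from (Bool.T-≡ {is-just (classify? W b)}) (allVec-sound 7 classifiable classify-total (b ∷ W)))

h7-two-clique-vertices : ∀ {i} → i ≡ 3 ⊎ i ≡ 4 → ClawOrZ2 (Attached 2 (h7-pattern i) (λ _ → false))
h7-two-clique-vertices (inj₁ refl) = from-just (clawOrZ2? (Attached 2 (h7-pattern 3) (λ _ → false)) zero)
h7-two-clique-vertices (inj₂ refl) = from-just (clawOrZ2? (Attached 2 (h7-pattern 4) (λ _ → false)) zero)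

isolated-no-neighbour : ∀ {k} (x : Fin (6 + k)) → attachment (replicate 6 false) (λ _ → false) x ≢ true
isolated-no-neighbour x with splitAt 6 x
... | inj₁ i = λ e → contradiction (trans (sym (lookup-replicate i false)) e) λ ()
... | inj₂ _ = λ ()

module Neighbourhood {G : Graph} (claw-free : Free G K13) (z2-free : Free G Z2)
  {m : ℕ} (f : Fin (6 + suc m) → V G) (f-emb : InducedEmb (H5exp (suc m)) G f)
  (a : V G) (a∉f : ∀ x → f x ≢ a) where

  W : Vec Bool 6
  W = tabulate λ i → adj G a (f (i ↑ˡ suc m))

  β : Fin (suc m) → Bool
  β c = adj G a (f (6 ↑ʳ c))

  decomposition : ∀ x → adj G a (f x) ≡ attachment W β x
  decomposition x = begin
    adj G a (f x)                              ≡⟨ cong (adj G a ∘ f) (Fin.join-splitAt 6 (suc m) x) ⟨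
    adj G a (f (join 6 (suc m) (splitAt 6 x))) ≡⟨ split (splitAt 6 x) ⟩
    attachment W β x                           ∎
    where
    open ≡-Reasoning
    split : ∀ s → adj G a (f (join 6 (suc m) s)) ≡ [ lookup W , β ]′ s
    split (inj₁ i) = sym (lookup∘tabulate (λ i → adj G a (f (i ↑ˡ suc m))) i)
    split (inj₂ c) = refl

  admissible-at : ∀ c → Admissible W (β c)
  admissible-at c with classify W (β c)
  ... | inj₂ adm = adm
  ... | inj₁ obs =
    ⊥-elim (ClawOrZ2-free {G} {Attached 1 W (λ _ → β c)} claw-free z2-free local-emb obs)
    where
    const-inj : Injective _≡_ _≡_ (λ (_ : Fin 1) → c)
    const-inj {zero} {zero} _ = refl
    local-emb = attached-emb {G} {1} {suc m} {W = W} {β} f-emb a∉f decomposition const-inj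

  admissible-attachment :
    ∃[ W ] ∃[ b ] (Admissible W b × (∀ x → adj G a (f x) ≡ attachment W (λ _ → b) x))
  admissible-attachment = W , β zero , admissible-at zero ,
    λ x → trans (decomposition x) (clique-uniform (splitAt 6 x))
    where
    clique-uniform : ∀ s → [ lookup W , β ]′ s ≡ [ lookup W , (λ _ → β zero) ]′ s
    clique-uniform (inj₁ i) = refl
    clique-uniform (inj₂ c) =
      trans (Admissible-clique (admissible-at c)) (sym (Admissible-clique (admissible-at zero)))

module TwinExtension {m : ℕ} where

  c₀ : Fin (6 + suc m)
  c₀ = 6 ↑ʳ zero

  grow : Fin (suc (6 + m)) → Fin (6 + suc m)
  grow = c₀ Vector.∷ liftClique suc

  shrink-split : Fin 6 ⊎ Fin (suc m) → Fin (suc (6 + m))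
  shrink-split (inj₁ i)       = suc (i ↑ˡ m)
  shrink-split (inj₂ zero)    = zero
  shrink-split (inj₂ (suc c)) = suc (6 ↑ʳ c)

  shrink : Fin (6 + suc m) → Fin (suc (6 + m))
  shrink = shrink-split ∘ splitAt 6

  grow-shrink : ∀ y → grow (shrink y) ≡ y
  grow-shrink y = trans (grow-split (splitAt 6 y)) (Fin.join-splitAt 6 (suc m) y)
    where
    grow-split : ∀ s → grow (shrink-split s) ≡ join 6 (suc m) s
    grow-split (inj₁ i)       = cong (join 6 (suc m) ∘ map₂ suc) (Fin.splitAt-↑ˡ 6 i m)
    grow-split (inj₂ zero)    = refl
    grow-split (inj₂ (suc c)) = cong (join 6 (suc m) ∘ map₂ suc) (Fin.splitAt-↑ʳ 6 m c)

  liftClique-suc≢c₀ : ∀ x → liftClique suc x ≢ c₀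
  liftClique-suc≢c₀ x e = distinct (splitAt 6 x)
    (trans (sym (splitAt-liftClique suc x)) (cong (splitAt 6) e))
    where
    distinct : ∀ s → map₂ suc s ≢ inj₂ zero
    distinct (inj₁ _) ()
    distinct (inj₂ _) ()

  c₀-adj : ∀ x → adj (H5exp (suc m)) c₀ (liftClique suc x) ≡ attachment twin-pattern (λ _ → true) x
  c₀-adj x = begin
    adj (H5exp (suc m)) c₀ (liftClique suc x)
      ≡⟨ H5exp-adj (suc m) c₀ (liftClique suc x) ⟩
    not ⌊ c₀ Fin.≟ liftClique suc x ⌋ ∧ originAdj (fromℕ 6) (origin (suc m) (liftClique suc x))
      ≡⟨ cong₂ (λ d o → not d ∧ o) c₀≢ (cong (originAdj (fromℕ 6)) (origin-liftClique suc x)) ⟩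
    originAdj (fromℕ 6) (origin m x)
      ≡⟨ cong (originAdj (fromℕ 6)) (origin-splitAt m x) ⟩
    originAdj (fromℕ 6) ([ _↑ˡ 1 , (λ _ → fromℕ 6) ]′ (splitAt 6 x))
      ≡⟨ by-origin (splitAt 6 x) ⟩
    attachment twin-pattern (λ _ → true) x
      ∎
    where
    open ≡-Reasoning
    c₀≢ : ⌊ c₀ Fin.≟ liftClique suc x ⌋ ≡ false
    c₀≢ = trans (isYes≗does (c₀ Fin.≟ liftClique suc x))
                (dec-false (c₀ Fin.≟ liftClique suc x) (liftClique-suc≢c₀ x ∘ sym))
    by-origin : ∀ s → originAdj (fromℕ 6) ([ _↑ˡ 1 , (λ _ → fromℕ 6) ]′ s)
                    ≡ [ lookup twin-pattern , (λ _ → true) ]′ s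
    by-origin (inj₁ i) = sym (lookup∘tabulate (λ i → originAdj (fromℕ 6) (i ↑ˡ 1)) i)
    by-origin (inj₂ _) = refl

  grow-emb : InducedEmb (Attached m twin-pattern (λ _ → true)) (H5exp (suc m)) grow
  grow-emb = addVertex-emb {H5exp m} {H5exp (suc m)} _
    (liftClique-emb Fin.suc-injective) liftClique-suc≢c₀ c₀-adj

  twin-extension : ∀ {G} (f : Fin (6 + m) → V G) → InducedEmb (H5exp m) G f →
    (a : V G) → (∀ x → f x ≢ a) → (∀ x → adj G a (f x) ≡ attachment twin-pattern (λ _ → true) x) →
    ∃[ g ] (InducedEmb (H5exp (suc m)) G g × (∀ v → (∃[ y ] g y ≡ v) ⇔ (v ≡ a ⊎ (∃[ x ] f x ≡ v))))
  twin-extension {G} f f-emb a a∉f a-adj = g , g-emb , λ v → mk⇔ (image-to v) (image-from v)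
    where
    H⁺ = Attached m twin-pattern (λ _ → true)
    a∷f = a Vector.∷ f
    g = a∷f ∘ shrink
    g-emb = InducedEmb-∘ {H5exp (suc m)} {H⁺} {G}
              (InducedEmb-inverse {H⁺} {H5exp (suc m)} shrink grow-emb grow-shrink)
              (addVertex-emb {H5exp m} {G} _ f-emb a∉f a-adj)
    image-to : ∀ v → ∃[ y ] g y ≡ v → v ≡ a ⊎ (∃[ x ] f x ≡ v)
    image-to v (y , e) = case (shrink y) e
      where
      case : ∀ s → a∷f s ≡ v → v ≡ a ⊎ (∃[ x ] f x ≡ v)
      case zero    e = inj₁ (sym e)
      case (suc x) e = inj₂ (x , e)
    image-from : ∀ v → v ≡ a ⊎ (∃[ x ] f x ≡ v) → ∃[ y ] g y ≡ v
    image-from v (inj₁ refl)       = c₀ , refl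
    image-from v (inj₂ (x , refl)) = grow (suc x) , cong a∷f shrink-grow
      where
      shrink-grow : shrink (grow (suc x)) ≡ suc x
      shrink-grow = proj₁ grow-emb (grow-shrink (grow (suc x)))

_⇔-dec_ : ∀ {A B : Set} → Dec A → Dec B → Dec (A ⇔ B)
a? ⇔-dec b? = map′ (λ (ab , ba) → mk⇔ ab ba) (λ e → to e , from e) ((a? →-dec b?) ×-dec (b? →-dec a?))

IsW? : ∀ m j x → Dec (IsW m j x)
IsW? m j x = suc (toℕ x) ℕ.≟ j ×-dec j ℕ.≤? 6

H7Neighbours : ℕ → Set
H7Neighbours i = ∀ (x : Fin 7) →
  (attachment (h7-pattern i) (λ _ → false) x ≡ true) ⇔ (IsW 1 1 x ⊎ IsW 1 2 x ⊎ IsW 1 i x ⊎ IsW 1 (9 ∸ i) x)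

H7Neighbours? : ∀ i → Dec (H7Neighbours i)
H7Neighbours? i = Fin.all? λ x → (attachment (h7-pattern i) (λ _ → false) x Bool.≟ true)
  ⇔-dec (IsW? 1 1 x ⊎-dec IsW? 1 2 x ⊎-dec IsW? 1 i x ⊎-dec IsW? 1 (9 ∸ i) x)

h7-neighbours : ∀ {i} → i ≡ 3 ⊎ i ≡ 4 → H7Neighbours i
h7-neighbours (inj₁ refl) = from-yes (H7Neighbours? 3)
h7-neighbours (inj₂ refl) = from-yes (H7Neighbours? 4)

h7-outcome : ∀ {G} → Free G K13 → Free G Z2 → ∀ {m i} (f : Fin (6 + suc m) → V G) →
  InducedEmb (H5exp (suc m)) G f → ∀ {a} → (∀ x → f x ≢ a) → i ≡ 3 ⊎ i ≡ 4 →
  (∀ x → adj G a (f x) ≡ attachment (h7-pattern i) (λ _ → false) x) →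
  ((i ≡ 3 ⊎ i ≡ 4) × (∀ x → Adj G a (f x) ⇔
      (IsW (suc m) 1 x ⊎ IsW (suc m) 2 x ⊎ IsW (suc m) i x ⊎ IsW (suc m) (9 ∸ i) x)))
  × suc m ≡ 1
h7-outcome _ _ {zero} f _ _ i34 a-adj =
  (i34 , λ x → subst (λ b → (b ≡ true) ⇔ _) (sym (a-adj x)) (h7-neighbours i34 x)) , refl
h7-outcome {G} claw-free z2-free {suc m} {i} f f-emb a∉f i34 a-adj = ⊥-elim
  (ClawOrZ2-free {G} {Attached 2 (h7-pattern i) (λ _ → false)} claw-free z2-free
    (attached-emb {G} {2} {suc (suc m)} {W = h7-pattern i} {β = λ _ → false}
       f-emb a∉f a-adj (Fin.↑ˡ-injective m _ _))
    (h7-two-clique-vertices i34))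

lemma2p6 : (G : Graph) → Connected G → Free G K13 → Free G Z2 → Free G NetG →
    (m : ℕ) → 1 ≤ m → (f : Fin (6 + m) → V G) → InducedEmb (H5exp m) G f →
    (a : V G) → (∀ x → f x ≢ a) → (∃[ x ] Adj G a (f x)) →
    (∃[ m′ ] (1 ≤ m′ × (∃[ g ] (InducedEmb (H5exp m′) G g
        × (∀ v → (∃[ y ] g y ≡ v) ⇔ (v ≡ a ⊎ (∃[ x ] f x ≡ v)))))))
    ⊎ (∃[ i ] ((i ≡ 3 ⊎ i ≡ 4)
        × (∀ x → Adj G a (f x) ⇔ (IsW m 1 x ⊎ IsW m 2 x ⊎ IsW m i x ⊎ IsW m (9 ∸ i) x)))
       × m ≡ 1)
lemma2p6 G _ claw-free z2-free _ (suc m) _ f f-emb a a∉f (x , a~fx)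
  with Neighbourhood.admissible-attachment {G} claw-free z2-free f f-emb a a∉f
... | _ , _ , isolated , a-adj =
  ⊥-elim (isolated-no-neighbour x (trans (sym (a-adj x)) a~fx))
... | _ , _ , twin , a-adj =
  inj₁ (suc (suc m) , s≤s z≤n , TwinExtension.twin-extension {G = G} f f-emb a a∉f a-adj)
... | _ , _ , h7 i34 , a-adj = inj₂ (_ , h7-outcome {G} claw-free z2-free f f-emb a∉f i34 a-adj)
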